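{- Let $(\mathcal{K},\preceq_{\mathcal{K}})$ be an abstract elementary class in a language $L$, let $M,N\in\mathcal{K}$, let $L(M)=L\cup\{c_m:m\in|M|\}$ with new constant symbols, and let $\bar a=(m)_{m\in|M|}$ be the identity enumeration of $M$. Let $\mathcal{K}(M)$ be the class of $L(M)$-structures $(P,\bar c)$ with $P\in\mathcal{K}$ and $\bar c\in|P|^{|M|}$ (the interpretation of the new constants), ordered by $(P,\bar c)\preceq_{\mathcal{K}(M)}(Q,\bar d)$ iff $P\preceq_{\mathcal{K}}Q$ and $\bar c=\bar d$. Assume that $\mathcal{K}(M)$ satisfies the Local Robinson Property. Then there is a $\mathcal{K}$-embedding $j:M\to N$ if and only if there is $\bar b\in|N|^{|M|}$ such that $(M,\bar a)\equiv_{\mathcal{K}(M)}(N,\bar b)$.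
   Context: For an AEC $(\mathcal{K},\preceq_{\mathcal{K}})$ in language $L$, a $\mathcal{K}$-embedding $f:A\to B$ ($A,B\in\mathcal{K}$) is a map which is an $L$-isomorphism of $A$ onto some $A'\in\mathcal{K}$ with $A'\preceq_{\mathcal{K}}B$; $\mathrm{cat}(\mathcal{K})$ is the category with objects $\mathcal{K}$ and arrows the $\mathcal{K}$-embeddings. The relation $\equiv_{\mathcal{K}}$ is the equivalence relation on $\mathcal{K}$ generated by the arrows of $\mathrm{cat}(\mathcal{K})$: $M\equiv_{\mathcal{K}}N$ iff there are $P_0=M,P_1,\dots,P_n=N$ in $\mathcal{K}$ and a zigzag of $\mathcal{K}$-embeddings $P_0\to P_1\leftarrow P_2\to\cdots P_n$ (each consecutive pair joined by a $\mathcal{K}$-embedding in one direction or the other). An AEC $\mathcal{K}$ satisfies the Local Robinson Property (LRP) if for all $M_0,M_1\in\mathcal{K}$: $M_0\equiv_{\mathcal{K}}M_1$ iff there exist $N\in\mathcal{K}$ and $\mathcal{K}$-embeddings $j_0:M_0\to N$, $j_1:M_1\to N$. (The class $\mathcal{K}(M)$ defined in the claim is an AEC.) -}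

module Defs where

open import Data.Nat using (ℕ)
open import Data.Vec using (Vec; [])
import Data.Vec as Vec
open import Data.Product using (Σ; ∃; _×_; _,_; proj₁; proj₂)
open import Data.Sum using (_⊎_; inj₁; inj₂)
open import Relation.Binary.PropositionalEquality using (_≡_; refl)

record Language : Set₁ where
  field
    Fun      : Set
    funArity : Fun → ℕ
    Rel      : Set
    relArity : Rel → ℕ

open Language public

record Structure (L : Language) : Set₁ where
  field
    Carrier : Set
    fun     : (f : Fun L) → Vec Carrier (funArity L f) → Carrier
    rel     : (r : Rel L) → Vec Carrier (relArity L r) → Set

open Structure public

record Embedding {L : Language} (A B : Structure L) : Set where
  field
    map       : Carrier A → Carrier B
    injective : ∀ {x y} → map x ≡ map y → x ≡ y
    pres-fun  : ∀ f xs → map (fun A f xs) ≡ fun B f (Vec.map map xs)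
    pres-rel  : ∀ r xs → rel A r xs → rel B r (Vec.map map xs)
    refl-rel  : ∀ r xs → rel B r (Vec.map map xs) → rel A r xs

open Embedding public

record Iso {L : Language} (A B : Structure L) : Set where
  field
    emb  : Embedding A B
    surj : ∀ y → ∃ λ x → map emb x ≡ y

open Iso public

isoMap : ∀ {L} {A B : Structure L} → Iso A B → Carrier A → Carrier B
isoMap g = map (emb g)

-- Abstract classes: a class K of L-structures with a relation ≼.
-- "A ≼ B" (which in the paper includes "A is a substructure of B")
-- is represented by witnesses p, each coming with the inclusion
-- embedding  incl p : A → B  of A into B.

record AbstractClass (L : Language) : Set₂ where
  field
    K    : Structure L → Set₁
    _≼_  : Structure L → Structure L → Set₁
    incl : ∀ {A B} → A ≼ B → Embedding A B

  ι : ∀ {A B} → A ≼ B → Carrier A → Carrier B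
  ι p = map (incl p)

record AEC (L : Language) : Set₂ where
  field
    cls : AbstractClass L
  open AbstractClass cls
  field
    ≼⇒K₁     : ∀ {A B} → A ≼ B → K A
    ≼⇒K₂     : ∀ {A B} → A ≼ B → K B
    ≼-refl   : ∀ {A} → K A → Σ (A ≼ A) λ p → ∀ x → ι p x ≡ x
    ≼-trans  : ∀ {A B C} (p : A ≼ B) (q : B ≼ C) →
               Σ (A ≼ C) λ r → ∀ x → ι r x ≡ ι q (ι p x)
    K-iso    : ∀ {A B} → Iso A B → K A → K B
    ≼-iso    : ∀ {A B B'} (p : A ≼ B) (f : Iso B B') →
               Σ (Structure L) λ A' → Σ (A' ≼ B') λ q → Σ (Iso A A') λ g →
                 ∀ x → ι q (isoMap g x) ≡ isoMap f (ι p x)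
    -- ≼ depends only on the image of the inclusion (substructure = subset)
    ≼-reindex : ∀ {A A' B} (p : A ≼ B) (g : Iso A' A) →
                Σ (A' ≼ B) λ q → ∀ x → ι q x ≡ ι p (isoMap g x)
    coherence : ∀ {A B C} (p : A ≼ C) (q : B ≼ C) →
                (∀ x → ∃ λ y → ι q y ≡ ι p x) →
                Σ (A ≼ B) λ r → ∀ x → ι q (ι r x) ≡ ι p x

module _ {L : Language} (𝒦 : AbstractClass L) where
  open AbstractClass 𝒦

  record KEmbedding (A B : Structure L) : Set₁ where
    field
      A'    : Structure L
      A'∈K  : K A'
      sub   : A' ≼ B
      iso   : Iso A A'

  kmap : ∀ {A B} → KEmbedding A B → Carrier A → Carrier B
  kmap j x = ι (KEmbedding.sub j) (isoMap (KEmbedding.iso j) x)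

  -- the equivalence relation on K generated by K-embeddings (zigzags)
  data _≡K_ : Structure L → Structure L → Set₁ where
    zz-refl : ∀ {M} → K M → M ≡K M
    zz-fwd  : ∀ {M P Q} → M ≡K P → KEmbedding P Q → K Q → M ≡K Q
    zz-bwd  : ∀ {M P Q} → M ≡K P → KEmbedding Q P → K Q → M ≡K Q

  LRP : Set₁
  LRP = ∀ M₀ M₁ → K M₀ → K M₁ →
        (M₀ ≡K M₁ → Σ (Structure L) λ N → K N × KEmbedding M₀ N × KEmbedding M₁ N)
      × ((Σ (Structure L) λ N → K N × KEmbedding M₀ N × KEmbedding M₁ N) → M₀ ≡K M₁)

constArity : ∀ {L : Language} {C : Set} → Fun L ⊎ C → ℕ
constArity {L} (inj₁ f) = funArity L f
constArity     (inj₂ _) = 0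

L[_] : ∀ {L : Language} → Structure L → Language
L[_] {L} M = record
  { Fun      = Fun L ⊎ Carrier M
  ; funArity = constArity {L}
  ; Rel      = Rel L
  ; relArity = relArity L
  }

module _ {L : Language} (M : Structure L) where

  reduct : Structure L[ M ] → Structure L
  reduct Q = record
    { Carrier = Carrier Q
    ; fun     = λ f → fun Q (inj₁ f)
    ; rel     = rel Q
    }

  consts : (Q : Structure L[ M ]) → Carrier M → Carrier Q
  consts Q m = fun Q (inj₂ m) []

  expand : (P : Structure L) → (Carrier M → Carrier P) → Structure L[ M ]
  expand P c = record
    { Carrier = Carrier P
    ; fun     = λ { (inj₁ f) xs → fun P f xs ; (inj₂ m) [] → c m }
    ; rel     = rel P
    }

  private
    liftEmb : ∀ {Q₁ Q₂ : Structure L[ M ]} (e : Embedding (reduct Q₁) (reduct Q₂)) →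
              (∀ m → map e (consts Q₁ m) ≡ consts Q₂ m) → Embedding Q₁ Q₂
    liftEmb e pc = record
      { map       = map e
      ; injective = injective e
      ; pres-fun  = λ { (inj₁ f) xs → pres-fun e f xs ; (inj₂ m) [] → pc m }
      ; pres-rel  = pres-rel e
      ; refl-rel  = refl-rel e
      }

  K[_] : AbstractClass L → AbstractClass L[ M ]
  K[ 𝒦 ] = record
    { K    = λ Q → AbstractClass.K 𝒦 (reduct Q)
    ; _≼_  = λ Q₁ Q₂ → Σ (AbstractClass._≼_ 𝒦 (reduct Q₁) (reduct Q₂)) λ p →
                         ∀ m → AbstractClass.ι 𝒦 p (consts Q₁ m) ≡ consts Q₂ m
    ; incl = λ { (p , pc) → liftEmb (AbstractClass.incl 𝒦 p) pc }
    }

-- Two lemmas then carry the argument: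
--   * liftKEmbedding: a K-embedding j : P → P' is also a K(M)-embedding
--     (P, c̄) → (P', j ∘ c̄), for any c̄; with c̄ = ā this is a one-step
--     zigzag (M, ā) → (N, j ∘ ā).
--   * amalgam⇒KEmbedding: if the constants of Q₀ enumerate Q₀, then any
--     common K(M)-extension Q of Q₀ and Q₁ gives a K-embedding of the
--     reduct of Q₀ into the reduct of Q₁: both images in Q contain the
--     interpretations of the constants, so image(Q₀) ⊆ image(Q₁), and
--     coherence together with closure under isomorphism does the rest.
-- The theorem is the first lemma for "⇒", and the LRP followed by the
-- second lemma (with Q₀ = (M, ā), whose constants enumerate M) for "⇐".
module Submission where

open import Defs
open import Data.Product using (Σ; _×_; _,_; proj₁; proj₂; ∃)
open import Function using (id; _∘_)
open import Data.Vec using (Vec; [])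
import Data.Vec as Vec
open import Data.Vec.Properties using (map-∘; map-cong; map-id)
open import Data.Sum using (inj₁; inj₂)
open import Relation.Binary.PropositionalEquality

module _ {L : Language} where

  isoComp : {A B C : Structure L} → Iso A B → Iso B C → Iso A C
  isoComp {A} {B} {C} f g = record
    { emb = record
      { map       = g∘f
      ; injective = λ e → injective (emb f) (injective (emb g) e)
      ; pres-fun  = λ h xs → begin
          isoMap g (isoMap f (fun A h xs))            ≡⟨ cong (isoMap g) (pres-fun (emb f) h xs) ⟩
          isoMap g (fun B h (Vec.map (isoMap f) xs))  ≡⟨ pres-fun (emb g) h _ ⟩
          fun C h (Vec.map (isoMap g) (Vec.map (isoMap f) xs)) ≡⟨ cong (fun C h) (mapmap xs) ⟩
          fun C h (Vec.map g∘f xs)                    ∎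
      ; pres-rel  = λ r xs p → subst (rel C r) (mapmap xs)
                      (pres-rel (emb g) r _ (pres-rel (emb f) r xs p))
      ; refl-rel  = λ r xs p → refl-rel (emb f) r xs (refl-rel (emb g) r _
                      (subst (rel C r) (sym (mapmap xs)) p))
      }
    ; surj = λ z → let (y , gy≡z) = surj g z ; (x , fx≡y) = surj f y
                   in x , trans (cong (isoMap g) fx≡y) gy≡z
    }
    where
    open ≡-Reasoning
    g∘f : Carrier A → Carrier C
    g∘f = isoMap g ∘ isoMap f
    mapmap : ∀ {n} (xs : Vec (Carrier A) n) →
             Vec.map (isoMap g) (Vec.map (isoMap f) xs) ≡ Vec.map g∘f xs
    mapmap xs = sym (map-∘ (isoMap g) (isoMap f) xs)

  isoInv : {A B : Structure L} → Iso A B → Iso B A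
  isoInv {A} {B} f = record
    { emb = record
      { map       = inv
      ; injective = λ {x} {y} e → trans (sym (section x)) (trans (cong (isoMap f) e) (section y))
      ; pres-fun  = λ h xs → injective (emb f) (begin
          isoMap f (inv (fun B h xs))                 ≡⟨ section _ ⟩
          fun B h xs                                  ≡⟨ cong (fun B h) (sym (map-section xs)) ⟩
          fun B h (Vec.map (isoMap f) (Vec.map inv xs)) ≡⟨ sym (pres-fun (emb f) h _) ⟩
          isoMap f (fun A h (Vec.map inv xs))         ∎)
      ; pres-rel  = λ r xs p → refl-rel (emb f) r _ (subst (rel B r) (sym (map-section xs)) p)
      ; refl-rel  = λ r xs p → subst (rel B r) (map-section xs) (pres-rel (emb f) r _ p)
      }
    ; surj = λ x → isoMap f x , injective (emb f) (section (isoMap f x))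
    }
    where
    open ≡-Reasoning
    inv : Carrier B → Carrier A
    inv y = proj₁ (surj f y)
    section : ∀ y → isoMap f (inv y) ≡ y
    section y = proj₂ (surj f y)
    map-section : ∀ {n} (xs : Vec (Carrier B) n) → Vec.map (isoMap f) (Vec.map inv xs) ≡ xs
    map-section xs = trans (sym (map-∘ (isoMap f) inv xs)) (trans (map-cong section xs) (map-id xs))

module _ {L : Language} (M : Structure L) where

  reductIso : {Q₁ Q₂ : Structure L[ M ]} → Iso Q₁ Q₂ → Iso (reduct M Q₁) (reduct M Q₂)
  reductIso f = record
    { emb = record
      { map       = isoMap f
      ; injective = injective (emb f)
      ; pres-fun  = λ h xs → pres-fun (emb f) (inj₁ h) xs
      ; pres-rel  = pres-rel (emb f)
      ; refl-rel  = refl-rel (emb f)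
      }
    ; surj = surj f
    }

  expandIso : {P P' : Structure L} (f : Iso P P') (c : Carrier M → Carrier P) →
              Iso (expand M P c) (expand M P' (isoMap f ∘ c))
  expandIso f c = record
    { emb = record
      { map       = isoMap f
      ; injective = injective (emb f)
      ; pres-fun  = λ { (inj₁ h) xs → pres-fun (emb f) h xs ; (inj₂ m) [] → refl }
      ; pres-rel  = pres-rel (emb f)
      ; refl-rel  = refl-rel (emb f)
      }
    ; surj = surj f
    }

module _ {L : Language} (𝒦 : AEC L) (M : Structure L) where
  open AEC 𝒦
  open AbstractClass cls

  kmap-consts : {Q₁ Q₂ : Structure L[ M ]} (j : KEmbedding (K[ M ] cls) Q₁ Q₂) (m : Carrier M) →
                kmap (K[ M ] cls) j (consts M Q₁ m) ≡ consts M Q₂ m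
  kmap-consts j m = trans (cong (ι (proj₁ sub)) (pres-fun (emb iso) (inj₂ m) [])) (proj₂ sub m)
    where open KEmbedding j

  liftKEmbedding : {P P' : Structure L} (j : KEmbedding cls P P') (c : Carrier M → Carrier P) →
                   KEmbedding (K[ M ] cls) (expand M P c) (expand M P' (kmap cls j ∘ c))
  liftKEmbedding j c = record
    { A'   = expand M A' (isoMap iso ∘ c)
    ; A'∈K = A'∈K
    ; sub  = sub , λ m → refl
    ; iso  = expandIso M iso c
    }
    where open KEmbedding j

  amalgam⇒KEmbedding : {Q₀ Q₁ Q : Structure L[ M ]} →
                       (∀ x → ∃ λ m → consts M Q₀ m ≡ x) →
                       KEmbedding (K[ M ] cls) Q₀ Q → KEmbedding (K[ M ] cls) Q₁ Q →
                       KEmbedding cls (reduct M Q₀) (reduct M Q₁)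
  amalgam⇒KEmbedding {Q₀} {Q₁} {Q} enum j₀ j₁ = record
    { A'   = proj₁ transported
    ; A'∈K = ≼⇒K₁ (proj₁ (proj₂ transported))
    ; sub  = proj₁ (proj₂ transported)
    ; iso  = isoComp (reductIso M J₀.iso) (proj₁ (proj₂ (proj₂ transported)))
    }
    where
    module J₀ = KEmbedding j₀
    module J₁ = KEmbedding j₁
    -- the image of Q₀ in Q lies in the image of Q₁: every element of Q₀ is
    -- some c_m, and both embeddings send c_m to the c_m of Q
    image⊆ : ∀ x → ∃ λ y → ι (proj₁ J₁.sub) y ≡ ι (proj₁ J₀.sub) x
    image⊆ x with enum (proj₁ (surj J₀.iso x))
    ... | m , cm≡x₀ =
      isoMap J₁.iso (consts M Q₁ m) ,
      (begin
        kmap (K[ M ] cls) j₁ (consts M Q₁ m) ≡⟨ kmap-consts j₁ m ⟩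
        consts M Q m                         ≡⟨ sym (kmap-consts j₀ m) ⟩
        kmap (K[ M ] cls) j₀ (consts M Q₀ m) ≡⟨ cong (kmap (K[ M ] cls) j₀) cm≡x₀ ⟩
        ι (proj₁ J₀.sub) (isoMap J₀.iso _)   ≡⟨ cong (ι (proj₁ J₀.sub)) (proj₂ (surj J₀.iso x)) ⟩
        ι (proj₁ J₀.sub) x                   ∎)
      where open ≡-Reasoning
    image₀≼image₁ : reduct M J₀.A' ≼ reduct M J₁.A'
    image₀≼image₁ = proj₁ (coherence (proj₁ J₀.sub) (proj₁ J₁.sub) image⊆)
    transported : Σ (Structure L) λ A' → Σ (A' ≼ reduct M Q₁) λ q → Σ (Iso (reduct M J₀.A') A') λ g →
                    ∀ x → ι q (isoMap g x) ≡ isoMap (isoInv (reductIso M J₁.iso)) (ι image₀≼image₁ x)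
    transported = ≼-iso image₀≼image₁ (isoInv (reductIso M J₁.iso))

proposition2p15 : ∀ {L : Language} (𝒦 : AEC L) (M N : Structure L) →
    AbstractClass.K (AEC.cls 𝒦) M → AbstractClass.K (AEC.cls 𝒦) N →
    LRP (K[ M ] (AEC.cls 𝒦)) →
    (KEmbedding (AEC.cls 𝒦) M N →
       Σ (Carrier M → Carrier N) λ b → _≡K_ (K[ M ] (AEC.cls 𝒦)) (expand M M id) (expand M N b))
    × ((Σ (Carrier M → Carrier N) λ b → _≡K_ (K[ M ] (AEC.cls 𝒦)) (expand M M id) (expand M N b)) →
       KEmbedding (AEC.cls 𝒦) M N)
proposition2p15 𝒦 M N M∈K N∈K lrp =
    (λ j → kmap (AEC.cls 𝒦) j , zz-fwd (zz-refl M∈K) (liftKEmbedding 𝒦 M j id) N∈K)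
  , λ { (b , M≡N) →
        let (_ , _ , j₀ , j₁) = proj₁ (lrp (expand M M id) (expand M N b) M∈K N∈K) M≡N
        in amalgam⇒KEmbedding 𝒦 M (λ x → x , refl) j₀ j₁ }
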